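{- Let $J\subseteq\{0,1,\dots,n-1\}$, let $G_J=\langle s_i: i\in J\rangle$ be the parabolic subgroup of $G(r,n)$ generated by $\{s_i:i\in J\}$, and let $G^J=\{\tau\in G(r,n):\mathrm{Des}_G(\tau)\subseteq\{0,\dots,n-1\}\setminus J\}$. Then every $\gamma\in G(r,n)$ has a unique factorization $\gamma=\tau\cdot\delta$ with $\tau\in G^J$ and $\delta\in G_J$, and this factorization satisfies $\ell_G(\gamma)=\ell_G(\tau)+\ell_G(\delta)$ and $\mathrm{col}(\gamma)=\mathrm{col}(\tau)+\mathrm{col}(\delta)$.
   Context: $G(r,n)$ is the group of $r$-colored permutations $\gamma=(c_1,\dots,c_n;\sigma)$, $c_i\in\mathbb Z_r=\{0,\dots,r-1\}$, $\sigma\in S_n$, written $\gamma=[\gamma(1),\dots,\gamma(n)]=[\sigma(1)^{c_1},\dots,\sigma(n)^{c_n}]$ (exponent $0$ omitted), with product $(c_1,\dots,c_n;\sigma)\cdot(d_1,\dots,d_n;\tau)=(d_1+c_{\tau(1)},\dots,d_n+c_{\tau(n)};\sigma\tau)$ (colors mod $r$, permutations composed right to left); in window notation $(\gamma\delta)(i)$ is $\gamma(|\delta(i)|)$ with its color increased by that of $\delta(i)$. Generators: $s_0=[1^1,2,\dots,n]$ and, for $i\in[n-1]$, $s_i=[1,\dots,i-1,i+1,i,i+2,\dots,n]$. Colored integers $x^c$ ($x^0=x$) are totally ordered by: uncolored integers in natural order; every $x^c$ with $c\ge1$ is smaller than every uncolored integer (including $0$); for $c,d\ge1$, $x^c<y^d$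 iff $x>y$, or $x=y$ and $c>d$. $\mathrm{Des}_G(\gamma)=\{i\in\{0,\dots,n-1\}:\gamma(i)>\gamma(i+1)\}$ with $\gamma(0):=0$; $\mathrm{col}(\gamma)=\sum_ic_i$; $\mathrm{inv}(\gamma)=\#\{(i,j):1\le i<j\le n,\ \gamma(i)>\gamma(j)\}$; $\ell_G(\gamma)=\mathrm{inv}(\gamma)+\sum_{i:\,c_i\ne0}(\sigma(i)+c_i-1)$. -}

module Defs where

open import Data.Nat using (ℕ; zero; suc; _+_; _<_; _<ᵇ_; _≡ᵇ_; NonZero)
open import Data.Nat.DivMod using (_%_)
open import Data.Fin using (Fin; toℕ; inject₁; pred) renaming (zero to fzero; suc to fsuc)
import Data.Fin as F
open import Data.Fin.Subset using (Subset; _∈_)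
open import Data.Vec using (Vec; lookup; tabulate; sum)
open import Data.Bool using (Bool; true; false; if_then_else_; _∧_; _∨_)
open import Data.Product using (_×_; _,_; proj₁; proj₂)
open import Relation.Nullary using (¬_; does)
open import Relation.Binary.PropositionalEquality using (_≡_)

-- An r-colored permutation of [n] in window notation:
-- position i (0-based Fin n, i.e. position i+1) holds (σ(i+1) - 1 , c_{i+1}),
-- the value is stored 0-based as an element of Fin n, the color as a natural.
Win : ℕ → Set
Win n = Vec (Fin n × ℕ) n

IsColPerm : (r : ℕ) {n : ℕ} → Win n → Set
IsColPerm r {n} γ =
  ((i : Fin n) → proj₂ (lookup γ i) < r) ×
  ((i j : Fin n) → proj₁ (lookup γ i) ≡ proj₁ (lookup γ j) → i ≡ j)

-- Product (c;σ)·(d;τ) = (d_i + c_{τ(i)} mod r ; στ).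
mul : (r : ℕ) {{_ : NonZero r}} {n : ℕ} → Win n → Win n → Win n
mul r γ δ = tabulate λ i →
  let j = proj₁ (lookup δ i) ; d = proj₂ (lookup δ i) in
  (proj₁ (lookup γ j) , (d + proj₂ (lookup γ j)) % r)

identity : {n : ℕ} → Win n
identity = tabulate λ p → (p , 0)

-- Generator s_i for i ∈ {0,…,n-1}: s_0 = [1^1,2,…,n];
-- s_i (i ≥ 1) swaps positions i and i+1 (0-based: pred i and i).
gen : (r : ℕ) {{_ : NonZero r}} {n : ℕ} → Fin n → Win n
gen r {n} i = tabulate λ p → (swp p , col p)
  where
  swp : Fin n → Fin n
  swp p = if does (p F.≟ i) then pred i
          else (if does (p F.≟ pred i) then i else p)
  col : Fin n → ℕ
  col p = if (toℕ i ≡ᵇ 0) ∧ (toℕ p ≡ᵇ 0) then 1 % r else 0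

data InGJ (r : ℕ) {{_ : NonZero r}} {n : ℕ} (J : Subset n) : Win n → Set where
  g-id  : InGJ r J identity
  g-gen : (i : Fin n) → i ∈ J → InGJ r J (gen r i)
  g-mul : {a b : Win n} → InGJ r J a → InGJ r J b → InGJ r J (mul r a b)
  g-inv : {a b : Win n} → InGJ r J a → IsColPerm r b →
          mul r a b ≡ identity → InGJ r J b

-- Colored integers x^c as pairs (x , c).  Strict order: ltB a b = true iff a < b.
ltB : ℕ × ℕ → ℕ × ℕ → Bool
ltB (x , zero)  (y , zero)  = x <ᵇ y
ltB (x , zero)  (y , suc d) = false
ltB (x , suc c) (y , zero)  = true
ltB (x , suc c) (y , suc d) = (y <ᵇ x) ∨ ((x ≡ᵇ y) ∧ (d <ᵇ c))

-- γ(i+1) as a colored integer (1-based value)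
entry : {n : ℕ} → Win n → Fin n → ℕ × ℕ
entry γ i = (suc (toℕ (proj₁ (lookup γ i))) , proj₂ (lookup γ i))

-- γ(i) for the descent at i ∈ {0,…,n-1}, with γ(0) := 0
prevEntry : {n : ℕ} → Win n → Fin n → ℕ × ℕ
prevEntry γ fzero    = (0 , 0)
prevEntry γ (fsuc k) = entry γ (inject₁ k)

IsDes : {n : ℕ} → Win n → Fin n → Set
IsDes γ i = ltB (entry γ i) (prevEntry γ i) ≡ true

InGJmin : {n : ℕ} → Subset n → Win n → Set
InGJmin {n} J τ = (i : Fin n) → i ∈ J → ¬ IsDes τ i

invG : {n : ℕ} → Win n → ℕ
invG {n} γ = sum (tabulate λ i → sum (tabulate λ j →
  if (toℕ i <ᵇ toℕ j) ∧ ltB (entry γ j) (entry γ i) then 1 else 0))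

-- ℓ_G(γ) = inv(γ) + Σ_{c_i ≠ 0} (σ(i) + c_i - 1)
lenTerm : ℕ × ℕ → ℕ
lenTerm (x , zero)  = 0
lenTerm (x , suc c) = x + c

lengthG : {n : ℕ} → Win n → ℕ
lengthG γ = invG γ + sum (tabulate λ i → lenTerm (entry γ i))

colG : {n : ℕ} → Win n → ℕ
colG γ = sum (tabulate λ i → proj₂ (lookup γ i))

module Submission where

-- G_J consists of colored permutations that keep every position inside its block of J (the maximal
-- intervals joined by the s_k, k ∈ J) and that color only the block of position 0, and only if 0 ∈ J.
-- An element τ of G^J is increasing and uncolored along these blocks, so for such δ the product τδ
-- compares positions inside a block exactly as δ does: Des(τδ) ∩ J = Des(δ) ∩ J.  In particular
-- G^J ∩ G_J = {1}, which gives uniqueness.  Existence and additivity follow by induction on ℓ_G: a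
-- descent i ∈ J of γ is removed by right multiplication with s_i (i ≥ 1), lowering ℓ_G by 1 and
-- keeping col, or with s_0^(r-c) (i = 0, γ(1) of color c), lowering both ℓ_G and col by c; undoing
-- this step on the G_J factor raises its length and color by the same amounts.

open import Defs
open import Data.Nat using (ℕ; zero; suc; pred; ≢-nonZero; _+_; _∸_; _≤_; _<_; _<ᵇ_; NonZero; z≤n; s≤s; s≤s⁻¹; z<s; s<s; >-nonZero⁻¹)
open import Data.Nat.Properties
open import Data.Nat.DivMod using (_%_; m%n<n; %-distribˡ-+; m<n⇒m%n≡m; n%n≡0; m%n%n≡m%n)
open import Data.Nat.Induction using (<-wellFounded)
open import Data.Nat.Solver using (module +-*-Solver)
open import Data.Fin using (Fin; toℕ; inject₁; punchOut) renaming (zero to fzero; suc to fsuc)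
import Data.Fin as F
import Data.Fin.Properties as FP
open import Data.Fin.Subset using (Subset; _∈_)
open import Data.Fin.Subset.Properties using (_∈?_)
open import Data.Fin.Permutation using (Permutation′; permutation)
open import Data.Vec using (Vec; lookup; tabulate; sum)
import Data.Vec.Properties as VP
open import Data.Bool using (Bool; true; false; if_then_else_; _∧_; T)
import Data.Bool.Properties as BP
open import Data.Product using (Σ; ∃; _×_; _,_; proj₁; proj₂)
open import Data.Sum using (_⊎_; inj₁; inj₂)
open import Data.Empty using (⊥-elim)
open import Relation.Nullary using (¬_; does; yes; no)
open import Relation.Nullary.Decidable using (_×-dec_; dec-true; dec-false)
open import Relation.Binary.PropositionalEquality
open import Relation.Binary.Definitions using (tri<; tri≈; tri>)
import Relation.Binary.Construct.On as On
open import Induction.WellFounded using (module All)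
open import Function using (_∘_; mk⇔; Equivalence)
import Algebra.Properties.CommutativeMonoid.Sum as CommutativeMonoidSum

T⇒≡true : ∀ {b} → T b → b ≡ true
T⇒≡true = Equivalence.to BP.T-≡

≡true⇒T : ∀ {b} → b ≡ true → T b
≡true⇒T = Equivalence.from BP.T-≡

¬T⇒≡false : ∀ {b} → ¬ T b → b ≡ false
¬T⇒≡false ¬b = BP.¬-not (¬b ∘ ≡true⇒T)

<⇒<ᵇ≡true : ∀ {m n} → m < n → (m <ᵇ n) ≡ true
<⇒<ᵇ≡true = T⇒≡true ∘ <⇒<ᵇ

≮⇒<ᵇ≡false : ∀ {m n} → ¬ m < n → (m <ᵇ n) ≡ false
≮⇒<ᵇ≡false {m} {n} m≮n = ¬T⇒≡false (m≮n ∘ <ᵇ⇒< m n)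

<ᵇ-irrefl : ∀ m → (m <ᵇ m) ≡ false
<ᵇ-irrefl m = ≮⇒<ᵇ≡false (n≮n m)

<ᵇ-cong : ∀ {m n m′ n′} → (m < n → m′ < n′) → (m′ < n′ → m < n) → (m <ᵇ n) ≡ (m′ <ᵇ n′)
<ᵇ-cong {m} {n} {m′} {n′} f g = BP.⇔→≡ (mk⇔ (<⇒<ᵇ≡true ∘ f ∘ <ᵇ⇒< m n ∘ ≡true⇒T)
                                              (<⇒<ᵇ≡true ∘ g ∘ <ᵇ⇒< m′ n′ ∘ ≡true⇒T))

infix 4 _<ᶜ_

data _<ᶜ_ : ℕ × ℕ → ℕ × ℕ → Set where
  plain<plain      : ∀ {x y} → x < y → (x , 0) <ᶜ (y , 0)
  colored<plain    : ∀ {x y c} → (x , suc c) <ᶜ (y , 0)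
  colored-by-value : ∀ {x y c d} → y < x → (x , suc c) <ᶜ (y , suc d)
  colored-by-color : ∀ {x c d} → d < c → (x , suc c) <ᶜ (x , suc d)

ltB⇒<ᶜ : ∀ a b → ltB a b ≡ true → a <ᶜ b
ltB⇒<ᶜ (x , zero)  (y , zero)  lt = plain<plain (<ᵇ⇒< x y (≡true⇒T lt))
ltB⇒<ᶜ (x , suc c) (y , zero)  _  = colored<plain
ltB⇒<ᶜ (x , suc c) (y , suc d) lt with Equivalence.to BP.T-∨ (≡true⇒T lt)
... | inj₁ y<x = colored-by-value (<ᵇ⇒< y x y<x)
... | inj₂ x≡y∧d<c with Equivalence.to BP.T-∧ x≡y∧d<c
...   | x≡y , d<c rewrite ≡ᵇ⇒≡ x y x≡y = colored-by-color (<ᵇ⇒< d c d<c)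

<ᶜ⇒ltB : ∀ {a b} → a <ᶜ b → ltB a b ≡ true
<ᶜ⇒ltB (plain<plain x<y)      = <⇒<ᵇ≡true x<y
<ᶜ⇒ltB colored<plain          = refl
<ᶜ⇒ltB (colored-by-value y<x) = T⇒≡true (Equivalence.from BP.T-∨ (inj₁ (<⇒<ᵇ y<x)))
<ᶜ⇒ltB {x , _} (colored-by-color d<c) =
  T⇒≡true (Equivalence.from BP.T-∨ (inj₂ (Equivalence.from BP.T-∧ (≡⇒≡ᵇ x x refl , <⇒<ᵇ d<c))))

¬<ᶜ⇒ltB≡false : ∀ {a b} → ¬ a <ᶜ b → ltB a b ≡ false
¬<ᶜ⇒ltB≡false {a} {b} a≮b = ¬T⇒≡false (a≮b ∘ ltB⇒<ᶜ a b ∘ T⇒≡true)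

ltB-cong : ∀ {a b a′ b′} → (a <ᶜ b → a′ <ᶜ b′) → (a′ <ᶜ b′ → a <ᶜ b) → ltB a b ≡ ltB a′ b′
ltB-cong {a} {b} {a′} {b′} f g = BP.⇔→≡ (mk⇔ (<ᶜ⇒ltB ∘ f ∘ ltB⇒<ᶜ a b) (<ᶜ⇒ltB ∘ g ∘ ltB⇒<ᶜ a′ b′))

<ᶜ-irrefl : ∀ {a} → ¬ a <ᶜ a
<ᶜ-irrefl (plain<plain p)      = n≮n _ p
<ᶜ-irrefl (colored-by-value p) = n≮n _ p
<ᶜ-irrefl (colored-by-color p) = n≮n _ p

<ᶜ-trans : ∀ {a b c} → a <ᶜ b → b <ᶜ c → a <ᶜ c
<ᶜ-trans (plain<plain p)      (plain<plain q)      = plain<plain (<-trans p q)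
<ᶜ-trans colored<plain        (plain<plain q)      = colored<plain
<ᶜ-trans (colored-by-value p) colored<plain        = colored<plain
<ᶜ-trans (colored-by-color p) colored<plain        = colored<plain
<ᶜ-trans (colored-by-value p) (colored-by-value q) = colored-by-value (<-trans q p)
<ᶜ-trans (colored-by-value p) (colored-by-color q) = colored-by-value p
<ᶜ-trans (colored-by-color p) (colored-by-value q) = colored-by-value q
<ᶜ-trans (colored-by-color p) (colored-by-color q) = colored-by-color (<-trans q p)

<ᶜ-asym : ∀ {a b} → a <ᶜ b → ¬ b <ᶜ a
<ᶜ-asym p q = <ᶜ-irrefl (<ᶜ-trans p q)

<ᶜ-connex : ∀ a b → proj₁ a ≢ proj₁ b → a <ᶜ b ⊎ b <ᶜ a
<ᶜ-connex (x , zero) (y , zero) x≢y with <-cmp x y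
... | tri< p _ _ = inj₁ (plain<plain p)
... | tri≈ _ e _ = ⊥-elim (x≢y e)
... | tri> _ _ p = inj₂ (plain<plain p)
<ᶜ-connex (x , zero)  (y , suc d) _ = inj₂ colored<plain
<ᶜ-connex (x , suc c) (y , zero)  _ = inj₁ colored<plain
<ᶜ-connex (x , suc c) (y , suc d) x≢y with <-cmp x y
... | tri< p _ _ = inj₂ (colored-by-value p)
... | tri≈ _ e _ = ⊥-elim (x≢y e)
... | tri> _ _ p = inj₁ (colored-by-value p)

<ᶜ-relabel : ∀ {x y x′ y′ c d} → (x < y → x′ < y′) → (y < x → y′ < x′) → (x ≡ y → x′ ≡ y′) →
             (x , c) <ᶜ (y , d) → (x′ , c) <ᶜ (y′ , d)
<ᶜ-relabel f g h (plain<plain p)      = plain<plain (f p)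
<ᶜ-relabel f g h colored<plain        = colored<plain
<ᶜ-relabel f g h (colored-by-value p) = colored-by-value (g p)
<ᶜ-relabel {x′ = x′} {c = suc c} {suc d} f g h (colored-by-color p) =
  subst (λ z → (x′ , suc c) <ᶜ (z , suc d)) (h refl) (colored-by-color p)

lookup-extensionality : ∀ {A : Set} {n} {u v : Vec A n} → (∀ i → lookup u i ≡ lookup v i) → u ≡ v
lookup-extensionality {u = u} {v} h =
  trans (sym (VP.tabulate∘lookup u)) (trans (VP.tabulate-cong h) (VP.tabulate∘lookup v))

inject₁-induction : ∀ {n} (P : Fin (suc n) → Set) → P fzero → (∀ k → P (inject₁ k) → P (fsuc k)) → ∀ i → P i
inject₁-induction P base step fzero = base
inject₁-induction {suc n} P base step (fsuc k) =
  step k (inject₁-induction (P ∘ inject₁) base (step ∘ inject₁) k)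

inject₁<suc : ∀ {m} (k : Fin m) → toℕ (inject₁ k) < toℕ (fsuc k)
inject₁<suc k = s≤s (≤-reflexive (FP.toℕ-inject₁ k))

inject₁≢suc : ∀ {m} (k : Fin m) → inject₁ k ≢ fsuc k
inject₁≢suc k e = <-irrefl (cong toℕ e) (inject₁<suc k)

injective⇒surjective : ∀ {n} (π : Fin n → Fin n) → (∀ i j → π i ≡ π j → i ≡ j) → ∀ y → ∃ λ x → π x ≡ y
injective⇒surjective {suc m} π inj y with FP.any? (λ x → π x F.≟ y)
... | yes p = p
... | no ¬p = ⊥-elim (n≮n m (FP.injective⇒≤ π-punchOut-injective))
  where
  π-punchOut : Fin (suc m) → Fin m
  π-punchOut x = punchOut {i = y} {j = π x} (λ e → ¬p (x , sym e))
  π-punchOut-injective : ∀ {x z} → π-punchOut x ≡ π-punchOut z → x ≡ z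
  π-punchOut-injective {x} {z} e =
    inj x z (FP.punchOut-injective {i = y} (λ e′ → ¬p (x , sym e′)) (λ e′ → ¬p (z , sym e′)) e)

∑ : ∀ {n} → (Fin n → ℕ) → ℕ
∑ f = sum (tabulate f)

private
  module ℕ-Sum = CommutativeMonoidSum +-0-commutativeMonoid

  ∑≡sum : ∀ {n} (f : Fin n → ℕ) → ∑ f ≡ ℕ-Sum.sum f
  ∑≡sum {zero}  f = refl
  ∑≡sum {suc n} f = cong (f fzero +_) (∑≡sum (f ∘ fsuc))

∑-cong : ∀ {n} {f g : Fin n → ℕ} → (∀ i → f i ≡ g i) → ∑ f ≡ ∑ g
∑-cong h = cong sum (VP.tabulate-cong h)

∑-zero : ∀ {n} → ∑ {n} (λ _ → 0) ≡ 0
∑-zero {zero}  = refl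
∑-zero {suc n} = ∑-zero {n}

∑-distrib-+ : ∀ {n} (f g : Fin n → ℕ) → ∑ (λ i → f i + g i) ≡ ∑ f + ∑ g
∑-distrib-+ f g = begin
  ∑ (λ i → f i + g i)               ≡⟨ ∑≡sum (λ i → f i + g i) ⟩
  ℕ-Sum.sum (λ i → f i + g i)       ≡⟨ ℕ-Sum.∑-distrib-+ f g ⟩
  ℕ-Sum.sum f + ℕ-Sum.sum g         ≡⟨ sym (cong₂ _+_ (∑≡sum f) (∑≡sum g)) ⟩
  ∑ f + ∑ g                         ∎
  where open ≡-Reasoning

∑-reindex : ∀ {n} (π : Fin n → Fin n) → (∀ i j → π i ≡ π j → i ≡ j) → (f : Fin n → ℕ) → ∑ (f ∘ π) ≡ ∑ f
∑-reindex {n} π inj f = begin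
  ∑ (f ∘ π)                ≡⟨ ∑≡sum (f ∘ π) ⟩
  ℕ-Sum.sum (f ∘ π)        ≡⟨ sym (ℕ-Sum.sum-permute f P) ⟩
  ℕ-Sum.sum f              ≡⟨ sym (∑≡sum f) ⟩
  ∑ f                      ∎
  where
  open ≡-Reasoning
  π⁻¹ : Fin n → Fin n
  π⁻¹ y = proj₁ (injective⇒surjective π inj y)
  P : Permutation′ n
  P = permutation π π⁻¹ (λ y → proj₂ (injective⇒surjective π inj y))
                         (λ x → inj _ _ (proj₂ (injective⇒surjective π inj (π x))))

∑-mono-≤ : ∀ {n} {f g : Fin n → ℕ} → (∀ i → f i ≤ g i) → ∑ f ≤ ∑ g
∑-mono-≤ {zero}  h = z≤n
∑-mono-≤ {suc n} h = +-mono-≤ (h fzero) (∑-mono-≤ (h ∘ fsuc))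

∑-mono-≤-≡⇒≗ : ∀ {n} {f g : Fin n → ℕ} → (∀ i → f i ≤ g i) → ∑ f ≡ ∑ g → ∀ i → f i ≡ g i
∑-mono-≤-≡⇒≗ {suc n} {f} {g} f≤g eq fzero = ≤-antisym (f≤g fzero)
  (+-cancelʳ-≤ (∑ (f ∘ fsuc)) _ _
    (≤-trans (+-monoʳ-≤ (g fzero) (∑-mono-≤ (f≤g ∘ fsuc))) (≤-reflexive (sym eq))))
∑-mono-≤-≡⇒≗ {suc n} {f} {g} f≤g eq (fsuc i) = ∑-mono-≤-≡⇒≗ (f≤g ∘ fsuc) tail-eq i
  where
  tail-eq : ∑ (f ∘ fsuc) ≡ ∑ (g ∘ fsuc)
  tail-eq = ≤-antisym (∑-mono-≤ (f≤g ∘ fsuc))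
    (+-cancelˡ-≤ (g fzero) _ _ (≤-trans (≤-reflexive (sym eq)) (+-monoˡ-≤ (∑ (f ∘ fsuc)) (f≤g fzero))))

-- Blocks of J

Between : ℕ → ℕ → ℕ → Set
Between a b k = (a < k × k ≤ b) ⊎ (b < k × k ≤ a)

Between-split : ∀ a b c k → Between a c k → Between a b k ⊎ Between b c k
Between-split a b c k (inj₁ (a<k , k≤c)) with k ≤? b
... | yes k≤b = inj₁ (inj₁ (a<k , k≤b))
... | no  k≰b = inj₂ (inj₁ (≰⇒> k≰b , k≤c))
Between-split a b c k (inj₂ (c<k , k≤a)) with k ≤? b
... | yes k≤b = inj₂ (inj₂ (c<k , k≤b))
... | no  k≰b = inj₁ (inj₂ (≰⇒> k≰b , k≤a))

Between-sym : ∀ a b k → Between a b k → Between b a k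
Between-sym a b k (inj₁ x) = inj₂ x
Between-sym a b k (inj₂ y) = inj₁ y

Between-irrefl : ∀ a k → ¬ Between a a k
Between-irrefl a k (inj₁ (p , q)) = <⇒≱ p q
Between-irrefl a k (inj₂ (p , q)) = <⇒≱ p q

Between-adjacent : ∀ {m} (k : Fin m) x → Between (toℕ (inject₁ k)) (toℕ (fsuc k)) (toℕ x) → x ≡ fsuc k
Between-adjacent k x (inj₁ (p , q)) = FP.toℕ-injective (≤-antisym q (subst (_< toℕ x) (FP.toℕ-inject₁ k) p))
Between-adjacent k x (inj₂ (p , q)) = ⊥-elim (<⇒≱ (<-≤-trans p q) (<⇒≤ (inject₁<suc k)))

-- s_k (k ≥ 1) swaps positions k - 1 and k, so x and y are joined by generators from J exactly
-- when every k in (min x y , max x y] lies in J.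
module Blocks {n : ℕ} (J : Subset n) where

  SameBlock : Fin n → Fin n → Set
  SameBlock x y = ∀ k → Between (toℕ x) (toℕ y) (toℕ k) → k ∈ J

  ColoredBlock : Fin n → Set
  ColoredBlock x = ∀ k → toℕ k ≤ toℕ x → k ∈ J

  SameBlock-refl : ∀ x → SameBlock x x
  SameBlock-refl x k b = ⊥-elim (Between-irrefl _ _ b)

  SameBlock-sym : ∀ {x y} → SameBlock x y → SameBlock y x
  SameBlock-sym l k b = l k (Between-sym _ _ _ b)

  SameBlock-trans : ∀ {x y z} → SameBlock x y → SameBlock y z → SameBlock x z
  SameBlock-trans {x} {y} {z} l₁ l₂ k b with Between-split (toℕ x) (toℕ y) (toℕ z) (toℕ k) b
  ... | inj₁ b′ = l₁ k b′
  ... | inj₂ b′ = l₂ k b′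

  ColoredBlock-transport : ∀ {x y} → ColoredBlock x → SameBlock x y → ColoredBlock y
  ColoredBlock-transport {x} c l k k≤y with toℕ k ≤? toℕ x
  ... | yes k≤x = c k k≤x
  ... | no  k≰x = l k (inj₁ (≰⇒> k≰x , k≤y))

open Blocks

ColoredBlock-zero : ∀ {m} (J : Subset (suc m)) → fzero ∈ J → ColoredBlock J fzero
ColoredBlock-zero J 0∈J k k≤0 = subst (_∈ J) (sym (FP.toℕ-injective {j = fzero} (n≤0⇒n≡0 k≤0))) 0∈J

SameBlock-adjacent : ∀ {m} (J : Subset (suc m)) (k : Fin m) → fsuc k ∈ J → SameBlock J (inject₁ k) (fsuc k)
SameBlock-adjacent J k k∈J x b = subst (_∈ J) (sym (Between-adjacent k x b)) k∈J

swap : ∀ {m} → Fin m → Fin (suc m) → Fin (suc m)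
swap k p = if does (p F.≟ fsuc k) then inject₁ k else (if does (p F.≟ inject₁ k) then fsuc k else p)

data SwapView {m} (k : Fin m) (p : Fin (suc m)) : Fin (suc m) → Set where
  at-suc     : p ≡ fsuc k → SwapView k p (inject₁ k)
  at-inject₁ : p ≡ inject₁ k → SwapView k p (fsuc k)
  elsewhere  : p ≢ fsuc k → p ≢ inject₁ k → SwapView k p p

swapView : ∀ {m} (k : Fin m) p → SwapView k p (swap k p)
swapView k p with p F.≟ fsuc k | p F.≟ inject₁ k
... | yes e  | _      = at-suc e
... | no  ne | yes e  = at-inject₁ e
... | no  ne | no ne′ = elsewhere ne ne′

swap-suc : ∀ {m} (k : Fin m) → swap k (fsuc k) ≡ inject₁ k
swap-suc k with swap k (fsuc k) | swapView k (fsuc k)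
... | _ | at-suc _       = refl
... | _ | at-inject₁ e   = ⊥-elim (inject₁≢suc k (sym e))
... | _ | elsewhere ne _ = ⊥-elim (ne refl)

swap-inject₁ : ∀ {m} (k : Fin m) → swap k (inject₁ k) ≡ fsuc k
swap-inject₁ k with swap k (inject₁ k) | swapView k (inject₁ k)
... | _ | at-suc e        = ⊥-elim (inject₁≢suc k e)
... | _ | at-inject₁ _    = refl
... | _ | elsewhere _ ne′ = ⊥-elim (ne′ refl)

swap-elsewhere : ∀ {m} (k : Fin m) {p} → p ≢ fsuc k → p ≢ inject₁ k → swap k p ≡ p
swap-elsewhere k {p} ne ne′ rewrite dec-false (p F.≟ fsuc k) ne | dec-false (p F.≟ inject₁ k) ne′ = refl

swap-involutive : ∀ {m} (k : Fin m) p → swap k (swap k p) ≡ p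
swap-involutive k p with swap k p | swapView k p
... | _ | at-suc refl       = swap-inject₁ k
... | _ | at-inject₁ refl   = swap-suc k
... | _ | elsewhere ne ne′  = swap-elsewhere k ne ne′

swap-injective : ∀ {m} (k : Fin m) i j → swap k i ≡ swap k j → i ≡ j
swap-injective k i j e = trans (sym (swap-involutive k i)) (trans (cong (swap k) e) (swap-involutive k j))

<ᵇ-outside-pairˡ : ∀ {m} (k : Fin m) {p} → p ≢ fsuc k → p ≢ inject₁ k → (toℕ (inject₁ k) <ᵇ toℕ p) ≡ (toℕ (fsuc k) <ᵇ toℕ p)
<ᵇ-outside-pairˡ k {p} p≢k+1 p≢k = <ᵇ-cong k<p⇒k+1<p (<-trans (inject₁<suc k))
  where
  k<p⇒k+1<p : toℕ (inject₁ k) < toℕ p → toℕ (fsuc k) < toℕ p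
  k<p⇒k+1<p k<p = ≤∧≢⇒< (subst (λ z → suc z ≤ toℕ p) (FP.toℕ-inject₁ k) k<p) (λ e → p≢k+1 (FP.toℕ-injective (sym e)))

<ᵇ-outside-pairʳ : ∀ {m} (k : Fin m) {p} → p ≢ fsuc k → p ≢ inject₁ k → (toℕ p <ᵇ toℕ (inject₁ k)) ≡ (toℕ p <ᵇ toℕ (fsuc k))
<ᵇ-outside-pairʳ k {p} p≢k+1 p≢k = <ᵇ-cong (λ p<k → <-trans p<k (inject₁<suc k)) p<k+1⇒p<k
  where
  p<k+1⇒p<k : toℕ p < toℕ (fsuc k) → toℕ p < toℕ (inject₁ k)
  p<k+1⇒p<k p<k+1 = ≤∧≢⇒< (subst (toℕ p ≤_) (sym (FP.toℕ-inject₁ k)) (s≤s⁻¹ p<k+1)) (λ e → p≢k (FP.toℕ-injective e))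

swap-preserves-<ᵇ : ∀ {m} (k : Fin m) a b → ¬ (a ≡ fsuc k × b ≡ inject₁ k) → ¬ (a ≡ inject₁ k × b ≡ fsuc k) →
                    (toℕ (swap k a) <ᵇ toℕ (swap k b)) ≡ (toℕ a <ᵇ toℕ b)
swap-preserves-<ᵇ k a b h₁ h₂ with swap k a | swapView k a | swap k b | swapView k b
... | _ | at-suc refl       | _ | at-suc refl       = trans (<ᵇ-irrefl (toℕ (inject₁ k))) (sym (<ᵇ-irrefl (toℕ (fsuc k))))
... | _ | at-suc refl       | _ | at-inject₁ refl   = ⊥-elim (h₁ (refl , refl))
... | _ | at-suc refl       | _ | elsewhere b₁ b₂   = <ᵇ-outside-pairˡ k b₁ b₂
... | _ | at-inject₁ refl   | _ | at-suc refl       = ⊥-elim (h₂ (refl , refl))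
... | _ | at-inject₁ refl   | _ | at-inject₁ refl   = trans (<ᵇ-irrefl (toℕ (fsuc k))) (sym (<ᵇ-irrefl (toℕ (inject₁ k))))
... | _ | at-inject₁ refl   | _ | elsewhere b₁ b₂   = sym (<ᵇ-outside-pairˡ k b₁ b₂)
... | _ | elsewhere a₁ a₂   | _ | at-suc refl       = <ᵇ-outside-pairʳ k a₁ a₂
... | _ | elsewhere a₁ a₂   | _ | at-inject₁ refl   = sym (<ᵇ-outside-pairʳ k a₁ a₂)
... | _ | elsewhere _ _     | _ | elsewhere _ _     = refl

indicator : Bool → ℕ
indicator b = if b then 1 else 0

∑-indicator-≡ : ∀ {n} (c : Fin n) → ∑ (λ b → indicator (does (b F.≟ c))) ≡ 1
∑-indicator-≡ {suc n} fzero    = cong suc (∑-zero {n})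
∑-indicator-≡ {suc n} (fsuc c) = ∑-indicator-≡ c

∑-indicator-< : ∀ {n} v → v ≤ n → ∑ {n} (λ q → indicator (toℕ q <ᵇ v)) ≡ v
∑-indicator-< {zero}  zero    _         = refl
∑-indicator-< {suc n} zero    _         = ∑-zero {n}
∑-indicator-< {suc n} (suc v) (s≤s v≤n) = cong suc (∑-indicator-< v v≤n)

indicator-below-plain : ∀ a e x c → a ≢ x → indicator (ltB (a , e) (x , 0)) ≡ indicator (ltB (a , e) (x , suc c)) + indicator (a <ᵇ x)
indicator-below-plain a zero    x c a≢x = refl
indicator-below-plain a (suc e) x c a≢x rewrite ¬T⇒≡false (a≢x ∘ ≡ᵇ⇒≡ a x) with <-cmp a x
... | tri< a<x _ x≮a rewrite ≮⇒<ᵇ≡false x≮a | <⇒<ᵇ≡true a<x = refl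
... | tri≈ _ a≡x _   = ⊥-elim (a≢x a≡x)
... | tri> a≮x _ x<a rewrite ≮⇒<ᵇ≡false a≮x | <⇒<ᵇ≡true x<a = refl

inversion : ∀ {n} → Win n → Fin n → Fin n → ℕ
inversion w i j = indicator ((toℕ i <ᵇ toℕ j) ∧ ltB (entry w j) (entry w i))

module ColoredPermutations (r : ℕ) {{_ : NonZero r}} where

  value : ∀ {n} → Win n → Fin n → Fin n
  value w i = proj₁ (lookup w i)

  color : ∀ {n} → Win n → Fin n → ℕ
  color w i = proj₂ (lookup w i)

  0%r≡0 : 0 % r ≡ 0
  0%r≡0 = m<n⇒m%n≡m (>-nonZero⁻¹ r)

  [m+n%r]%r≡[m+n]%r : ∀ m n → (m + n % r) % r ≡ (m + n) % r
  [m+n%r]%r≡[m+n]%r m n = begin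
    (m + n % r) % r              ≡⟨ %-distribˡ-+ m (n % r) r ⟩
    (m % r + n % r % r) % r      ≡⟨ cong (λ z → (m % r + z) % r) (m%n%n≡m%n n r) ⟩
    (m % r + n % r) % r          ≡⟨ sym (%-distribˡ-+ m n r) ⟩
    (m + n) % r                  ∎
    where open ≡-Reasoning

  [m%r+n]%r≡[m+n]%r : ∀ m n → (m % r + n) % r ≡ (m + n) % r
  [m%r+n]%r≡[m+n]%r m n = begin
    (m % r + n) % r   ≡⟨ cong (_% r) (+-comm (m % r) n) ⟩
    (n + m % r) % r   ≡⟨ [m+n%r]%r≡[m+n]%r n m ⟩
    (n + m) % r       ≡⟨ cong (_% r) (+-comm n m) ⟩
    (m + n) % r       ∎
    where open ≡-Reasoning

  color%r : ∀ {n} (w : Win n) → IsColPerm r w → ∀ i → color w i % r ≡ color w i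
  color%r w cp i = m<n⇒m%n≡m (proj₁ cp i)

  lookup-mul : ∀ {n} (a b : Win n) i →
               lookup (mul r a b) i ≡ (value a (value b i) , (color b i + color a (value b i)) % r)
  lookup-mul a b = VP.lookup∘tabulate _

  entry-mul : ∀ {n} (a b : Win n) i →
              entry (mul r a b) i ≡ (suc (toℕ (value a (value b i))) , (color b i + color a (value b i)) % r)
  entry-mul a b i = cong (λ z → (suc (toℕ (proj₁ z)) , proj₂ z)) (lookup-mul a b i)

  lookup-identity : ∀ {n} (p : Fin n) → lookup (identity {n}) p ≡ (p , 0)
  lookup-identity = VP.lookup∘tabulate _

  mul-assoc : ∀ {n} (a b c : Win n) → mul r (mul r a b) c ≡ mul r a (mul r b c)
  mul-assoc a b c = lookup-extensionality λ i →
    trans (lookup-mul (mul r a b) c i) (trans (same i) (sym (lookup-mul a (mul r b c) i)))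
    where
    colors-assoc : ∀ x y z → (x + (y + z) % r) % r ≡ ((x + y) % r + z) % r
    colors-assoc x y z = begin
      (x + (y + z) % r) % r  ≡⟨ [m+n%r]%r≡[m+n]%r x (y + z) ⟩
      (x + (y + z)) % r      ≡⟨ cong (_% r) (sym (+-assoc x y z)) ⟩
      (x + y + z) % r        ≡⟨ sym ([m%r+n]%r≡[m+n]%r (x + y) z) ⟩
      ((x + y) % r + z) % r  ∎
      where open ≡-Reasoning
    same : ∀ i → (value (mul r a b) (value c i) , (color c i + color (mul r a b) (value c i)) % r)
               ≡ (value a (value (mul r b c) i) , (color (mul r b c) i + color a (value (mul r b c) i)) % r)
    same i rewrite lookup-mul a b (value c i) | lookup-mul b c i =
      cong (value a (value b (value c i)) ,_) (colors-assoc (color c i) _ _)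

  mul-identityʳ : ∀ {n} (w : Win n) → IsColPerm r w → mul r w identity ≡ w
  mul-identityʳ w cp = lookup-extensionality λ i → begin
    lookup (mul r w identity) i                                     ≡⟨ lookup-mul w identity i ⟩
    (value w (value identity i) , (color identity i + color w (value identity i)) % r)
                                                                    ≡⟨ cong (λ z → (value w (proj₁ z) , (proj₂ z + color w (proj₁ z)) % r)) (lookup-identity i) ⟩
    (value w i , color w i % r)                                     ≡⟨ cong (value w i ,_) (color%r w cp i) ⟩
    lookup w i                                                      ∎
    where open ≡-Reasoning

  mul-colPerm : ∀ {n} (a b : Win n) → IsColPerm r a → IsColPerm r b → IsColPerm r (mul r a b)
  mul-colPerm a b ca cb =
    (λ i → subst (λ z → proj₂ z < r) (sym (lookup-mul a b i)) (m%n<n _ r)) ,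
    λ i j e → proj₂ cb i j (proj₂ ca _ _
      (trans (sym (cong proj₁ (lookup-mul a b i))) (trans e (cong proj₁ (lookup-mul a b j)))))

  diagonal-colPerm : ∀ {n} (c : Fin n → ℕ) → (∀ i → c i < r) → IsColPerm r (tabulate λ i → (i , c i))
  diagonal-colPerm c c<r =
    (λ i → subst (λ z → proj₂ z < r) (sym (VP.lookup∘tabulate _ i)) (c<r i)) ,
    λ i j e → trans (sym (cong proj₁ (VP.lookup∘tabulate _ i))) (trans e (cong proj₁ (VP.lookup∘tabulate _ j)))

  identity-colPerm : ∀ {n} → IsColPerm r (identity {n})
  identity-colPerm = diagonal-colPerm (λ _ → 0) (λ _ → >-nonZero⁻¹ r)

  adjacent : ∀ {m} → Fin m → Win (suc m)
  adjacent k = gen r (fsuc k)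

  lookup-adjacent : ∀ {m} (k : Fin m) p → lookup (adjacent k) p ≡ (swap k p , 0)
  lookup-adjacent k = VP.lookup∘tabulate _

  adjacent-colPerm : ∀ {m} (k : Fin m) → IsColPerm r (adjacent k)
  adjacent-colPerm k =
    (λ i → subst (λ z → proj₂ z < r) (sym (lookup-adjacent k i)) (>-nonZero⁻¹ r)) ,
    λ i j e → swap-injective k i j
      (trans (sym (cong proj₁ (lookup-adjacent k i))) (trans e (cong proj₁ (lookup-adjacent k j))))

  lookup-mul-adjacent : ∀ {m} (w : Win (suc m)) → IsColPerm r w → (k : Fin m) →
                        ∀ p → lookup (mul r w (adjacent k)) p ≡ lookup w (swap k p)
  lookup-mul-adjacent w cp k p rewrite lookup-mul w (adjacent k) p | lookup-adjacent k p =
    cong (value w (swap k p) ,_) (color%r w cp (swap k p))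

  entry-mul-adjacent : ∀ {m} (w : Win (suc m)) → IsColPerm r w → (k : Fin m) →
                       ∀ p → entry (mul r w (adjacent k)) p ≡ entry w (swap k p)
  entry-mul-adjacent w cp k p = cong (λ z → (suc (toℕ (proj₁ z)) , proj₂ z)) (lookup-mul-adjacent w cp k p)

  mul-adjacent-adjacent : ∀ {m} (w : Win (suc m)) → IsColPerm r w → (k : Fin m) →
                          mul r (mul r w (adjacent k)) (adjacent k) ≡ w
  mul-adjacent-adjacent w cp k = lookup-extensionality λ p → begin
    lookup (mul r (mul r w (adjacent k)) (adjacent k)) p
      ≡⟨ lookup-mul-adjacent (mul r w (adjacent k)) (mul-colPerm w (adjacent k) cp (adjacent-colPerm k)) k p ⟩
    lookup (mul r w (adjacent k)) (swap k p)  ≡⟨ lookup-mul-adjacent w cp k (swap k p) ⟩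
    lookup w (swap k (swap k p))              ≡⟨ cong (lookup w) (swap-involutive k p) ⟩
    lookup w p                                ∎
    where open ≡-Reasoning

  twistColor : ∀ {n} → ℕ → Fin n → ℕ
  twistColor c fzero    = c % r
  twistColor c (fsuc _) = 0

  twist : ∀ {n} → ℕ → Win n
  twist c = tabulate λ p → (p , twistColor c p)

  lookup-twist : ∀ {n} c (p : Fin n) → lookup (twist c) p ≡ (p , twistColor c p)
  lookup-twist c = VP.lookup∘tabulate _

  twist-colPerm : ∀ {n} c → IsColPerm r (twist {n} c)
  twist-colPerm c = diagonal-colPerm (twistColor c) twistColor<r
    where
    twistColor<r : ∀ {n} (p : Fin n) → twistColor c p < r
    twistColor<r fzero    = m%n<n c r
    twistColor<r (fsuc _) = >-nonZero⁻¹ r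

  gen-zero≡twist-1 : ∀ {m} → gen r {suc m} fzero ≡ twist 1
  gen-zero≡twist-1 = lookup-extensionality pointwise
    where
    pointwise : ∀ {m} (p : Fin (suc m)) → lookup (gen r fzero) p ≡ lookup (twist 1) p
    pointwise fzero    = refl
    pointwise (fsuc p) = trans (VP.lookup∘tabulate _ p) (sym (VP.lookup∘tabulate _ p))

  lookup-mul-twist : ∀ {n} (w : Win n) c p → lookup (mul r w (twist c)) p ≡ (value w p , (twistColor c p + color w p) % r)
  lookup-mul-twist w c p rewrite lookup-mul w (twist c) p | lookup-twist c p = refl

  lookup-mul-twist-suc : ∀ {m} (w : Win (suc m)) → IsColPerm r w → ∀ c p →
                         lookup (mul r w (twist c)) (fsuc p) ≡ lookup w (fsuc p)
  lookup-mul-twist-suc w cp c p = trans (lookup-mul-twist w c (fsuc p)) (cong (value w (fsuc p) ,_) (color%r w cp (fsuc p)))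

  twist-+ : ∀ {n} a b → mul r {n} (twist a) (twist b) ≡ twist (a + b)
  twist-+ a b = lookup-extensionality λ p →
    trans (lookup-mul-twist (twist a) b p) (trans (pointwise p) (sym (lookup-twist (a + b) p)))
    where
    pointwise : ∀ {n} (p : Fin n) → (value (twist a) p , (twistColor b p + color (twist a) p) % r) ≡ (p , twistColor (a + b) p)
    pointwise p rewrite lookup-twist a p with p
    ... | fzero  = cong (fzero ,_) (begin
      (b % r + a % r) % r   ≡⟨ cong (_% r) (+-comm (b % r) (a % r)) ⟩
      (a % r + b % r) % r   ≡⟨ sym (%-distribˡ-+ a b r) ⟩
      (a + b) % r           ∎)
      where open ≡-Reasoning
    ... | fsuc q = cong (fsuc q ,_) 0%r≡0

  twist-identity : ∀ {n} c → c % r ≡ 0 → twist {n} c ≡ identity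
  twist-identity c c%r≡0 = VP.tabulate-cong λ { fzero → cong (fzero ,_) c%r≡0 ; (fsuc p) → refl }

  mul-twist-cancel : ∀ {n} (w : Win n) → IsColPerm r w → ∀ c → c ≤ r → mul r (mul r w (twist (r ∸ c))) (twist c) ≡ w
  mul-twist-cancel w cp c c≤r = begin
    mul r (mul r w (twist (r ∸ c))) (twist c)  ≡⟨ mul-assoc w (twist (r ∸ c)) (twist c) ⟩
    mul r w (mul r (twist (r ∸ c)) (twist c))  ≡⟨ cong (mul r w) (twist-+ (r ∸ c) c) ⟩
    mul r w (twist (r ∸ c + c))                ≡⟨ cong (mul r w) (twist-identity _ (trans (cong (_% r) (m∸n+n≡m c≤r)) (n%n≡0 r))) ⟩
    mul r w identity                           ≡⟨ mul-identityʳ w cp ⟩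
    w                                          ∎
    where open ≡-Reasoning

  -- The parabolic subgroup G_J preserves the blocks of J

  record BlockPreserving {n} (J : Subset n) (δ : Win n) : Set where
    field
      colPerm      : IsColPerm r δ
      sameBlock    : ∀ p → SameBlock J p (value δ p)
      coloredBlock : ∀ p → color δ p ≢ 0 → ColoredBlock J p

  identity-blockPreserving : ∀ {n} (J : Subset n) → BlockPreserving J identity
  identity-blockPreserving J = record
    { colPerm      = identity-colPerm
    ; sameBlock    = λ p → subst (SameBlock J p) (sym (cong proj₁ (lookup-identity p))) (SameBlock-refl J p)
    ; coloredBlock = λ p c≢0 → ⊥-elim (c≢0 (cong proj₂ (lookup-identity p)))
    }

  mul-blockPreserving : ∀ {n} (J : Subset n) {a b} → BlockPreserving J a → BlockPreserving J b → BlockPreserving J (mul r a b)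
  mul-blockPreserving J {a} {b} A B = record
    { colPerm      = mul-colPerm a b (colPerm A) (colPerm B)
    ; sameBlock    = λ p → subst (SameBlock J p) (sym (cong proj₁ (lookup-mul a b p)))
                                 (SameBlock-trans J (sameBlock B p) (sameBlock A (value b p)))
    ; coloredBlock = λ p c≢0 → colored p (subst (_≢ 0) (cong proj₂ (lookup-mul a b p)) c≢0)
    }
    where
    open BlockPreserving
    colored : ∀ p → (color b p + color a (value b p)) % r ≢ 0 → ColoredBlock J p
    colored p c≢0 with color b p ≟ 0 | color a (value b p) ≟ 0
    ... | no  cb≢0 | _        = coloredBlock B p cb≢0
    ... | yes _    | no ca≢0  = ColoredBlock-transport J (coloredBlock A (value b p) ca≢0) (SameBlock-sym J (sameBlock B p))
    ... | yes cb≡0 | yes ca≡0 = ⊥-elim (c≢0 (trans (cong₂ (λ u v → (u + v) % r) cb≡0 ca≡0) 0%r≡0))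

  inverse-blockPreserving : ∀ {n} (J : Subset n) {a b} → BlockPreserving J a → IsColPerm r b →
                            mul r a b ≡ identity → BlockPreserving J b
  inverse-blockPreserving J {a} {b} A cb ab≡1 = record
    { colPerm      = cb
    ; sameBlock    = λ p → SameBlock-sym J (back p)
    ; coloredBlock = colored
    }
    where
    open BlockPreserving
    lookup-ab : ∀ p → (value a (value b p) , (color b p + color a (value b p)) % r) ≡ (p , 0)
    lookup-ab p = trans (sym (lookup-mul a b p)) (trans (cong (λ w → lookup w p) ab≡1) (lookup-identity p))
    back : ∀ p → SameBlock J (value b p) p
    back p = subst (SameBlock J (value b p)) (cong proj₁ (lookup-ab p)) (sameBlock A (value b p))
    colored : ∀ p → color b p ≢ 0 → ColoredBlock J p
    colored p cb≢0 with color a (value b p) ≟ 0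
    ... | no  ca≢0 = ColoredBlock-transport J (coloredBlock A (value b p) ca≢0) (back p)
    ... | yes ca≡0 = ⊥-elim (cb≢0 (begin
      color b p                                  ≡⟨ sym (color%r b cb p) ⟩
      color b p % r                              ≡⟨ cong (_% r) (sym (+-identityʳ _)) ⟩
      (color b p + 0) % r                        ≡⟨ cong (λ v → (color b p + v) % r) (sym ca≡0) ⟩
      (color b p + color a (value b p)) % r      ≡⟨ cong proj₂ (lookup-ab p) ⟩
      0                                          ∎))
      where open ≡-Reasoning

  adjacent-blockPreserving : ∀ {m} (J : Subset (suc m)) (k : Fin m) → fsuc k ∈ J → BlockPreserving J (adjacent k)
  adjacent-blockPreserving J k k∈J = record
    { colPerm      = adjacent-colPerm k
    ; sameBlock    = same
    ; coloredBlock = λ p c≢0 → ⊥-elim (c≢0 (cong proj₂ (lookup-adjacent k p)))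
    }
    where
    same : ∀ p → SameBlock J p (value (adjacent k) p)
    same p rewrite lookup-adjacent k p with swap k p | swapView k p
    ... | _ | at-suc refl     = SameBlock-sym J (SameBlock-adjacent J k k∈J)
    ... | _ | at-inject₁ refl = SameBlock-adjacent J k k∈J
    ... | _ | elsewhere _ _   = SameBlock-refl J p

  twist-1-blockPreserving : ∀ {m} (J : Subset (suc m)) → fzero ∈ J → BlockPreserving J (twist 1)
  twist-1-blockPreserving J 0∈J = record
    { colPerm      = twist-colPerm 1
    ; sameBlock    = λ p → subst (SameBlock J p) (sym (cong proj₁ (lookup-twist 1 p))) (SameBlock-refl J p)
    ; coloredBlock = colored
    }
    where
    colored : ∀ p → color (twist 1) p ≢ 0 → ColoredBlock J p
    colored fzero    _   = ColoredBlock-zero J 0∈J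
    colored (fsuc p) c≢0 = ⊥-elim (c≢0 (cong proj₂ (lookup-twist 1 (fsuc p))))

  gen-blockPreserving : ∀ {n} (J : Subset n) (i : Fin n) → i ∈ J → BlockPreserving J (gen r i)
  gen-blockPreserving {suc m} J fzero    0∈J = subst (BlockPreserving J) (sym gen-zero≡twist-1) (twist-1-blockPreserving J 0∈J)
  gen-blockPreserving {suc m} J (fsuc k) k∈J = adjacent-blockPreserving J k k∈J

  ∈G_J⇒blockPreserving : ∀ {n} {J : Subset n} {δ} → InGJ r J δ → BlockPreserving J δ
  ∈G_J⇒blockPreserving {J = J} g-id             = identity-blockPreserving J
  ∈G_J⇒blockPreserving {J = J} (g-gen i i∈J)    = gen-blockPreserving J i i∈J
  ∈G_J⇒blockPreserving {J = J} (g-mul a b)      = mul-blockPreserving J (∈G_J⇒blockPreserving a) (∈G_J⇒blockPreserving b)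
  ∈G_J⇒blockPreserving {J = J} (g-inv a cb ab≡1) = inverse-blockPreserving J (∈G_J⇒blockPreserving a) cb ab≡1

  ∈G_J⇒colPerm : ∀ {n} {J : Subset n} {δ} → InGJ r J δ → IsColPerm r δ
  ∈G_J⇒colPerm = BlockPreserving.colPerm ∘ ∈G_J⇒blockPreserving

  twist∈G_J : ∀ {m} (J : Subset (suc m)) → fzero ∈ J → ∀ c → InGJ r J (twist c)
  twist∈G_J J 0∈J zero    = subst (InGJ r J) (sym (twist-identity 0 0%r≡0)) g-id
  twist∈G_J J 0∈J (suc c) = subst (InGJ r J) (trans (twist-+ c 1) (cong twist (+-comm c 1)))
                              (g-mul (twist∈G_J J 0∈J c) (subst (InGJ r J) gen-zero≡twist-1 (g-gen fzero 0∈J)))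

  -- Minimal coset representatives

  entry-injective : ∀ {n} (w : Win n) → IsColPerm r w → ∀ {i j} → i ≢ j → proj₁ (entry w i) ≢ proj₁ (entry w j)
  entry-injective w cp {i} {j} i≢j e = i≢j (proj₂ cp i j (FP.toℕ-injective (suc-injective e)))

  <ᶜ-plainˡ : ∀ {x y c} → (x , 0) <ᶜ (y , c) → c ≡ 0
  <ᶜ-plainˡ (plain<plain _) = refl

  <ᶜ-plain⁻¹ : ∀ {x y} → (x , 0) <ᶜ (y , 0) → x < y
  <ᶜ-plain⁻¹ (plain<plain p) = p

  IsDes-zero⇒colored : ∀ {m} (w : Win (suc m)) → IsDes w fzero → color w fzero ≢ 0
  IsDes-zero⇒colored w d c≡0 with () ← subst (λ c → ltB (suc (toℕ (value w fzero)) , c) (0 , 0) ≡ true) c≡0 d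

  colored⇒IsDes-zero : ∀ {m} (w : Win (suc m)) → color w fzero ≢ 0 → IsDes w fzero
  colored⇒IsDes-zero w c≢0 with color w fzero
  ... | zero  = ⊥-elim (c≢0 refl)
  ... | suc c = refl

  module MinimalRepresentative {m} (J : Subset (suc m)) (τ : Win (suc m)) (cpτ : IsColPerm r τ) (minτ : InGJmin J τ) where

    valueℕ : Fin (suc m) → ℕ
    valueℕ q = toℕ (value τ q)

    ascent : (k : Fin m) → fsuc k ∈ J → entry τ (inject₁ k) <ᶜ entry τ (fsuc k)
    ascent k k∈J with <ᶜ-connex (entry τ (inject₁ k)) (entry τ (fsuc k)) (entry-injective τ cpτ (inject₁≢suc k))
    ... | inj₁ asc = asc
    ... | inj₂ des = ⊥-elim (minτ (fsuc k) k∈J (<ᶜ⇒ltB des))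

    increasing : ∀ q q′ → toℕ q < toℕ q′ → SameBlock J q q′ → entry τ q <ᶜ entry τ q′
    increasing q = inject₁-induction (λ q′ → toℕ q < toℕ q′ → SameBlock J q q′ → entry τ q <ᶜ entry τ q′) (λ ()) step
      where
      step : (k : Fin m) → (toℕ q < toℕ (inject₁ k) → SameBlock J q (inject₁ k) → entry τ q <ᶜ entry τ (inject₁ k)) →
             toℕ q < toℕ (fsuc k) → SameBlock J q (fsuc k) → entry τ q <ᶜ entry τ (fsuc k)
      step k ih q<k+1 q~k+1 with m≤n⇒m<n∨m≡n (s≤s⁻¹ q<k+1)
      ... | inj₂ q≡k = subst (λ z → entry τ z <ᶜ entry τ (fsuc k)) (sym (FP.toℕ-injective (trans q≡k (sym (FP.toℕ-inject₁ k)))))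
                             (ascent k k+1∈J)
        where k+1∈J = q~k+1 (fsuc k) (inj₁ (q<k+1 , ≤-refl))
      ... | inj₁ q<k = <ᶜ-trans (ih q<k′ q~k) (ascent k (q~k+1 (fsuc k) (inj₁ (q<k+1 , ≤-refl))))
        where
        q<k′ : toℕ q < toℕ (inject₁ k)
        q<k′ = subst (toℕ q <_) (sym (FP.toℕ-inject₁ k)) q<k
        q~k : SameBlock J q (inject₁ k)
        q~k x (inj₁ (q<x , x≤k)) = q~k+1 x (inj₁ (q<x , ≤-trans x≤k (<⇒≤ (inject₁<suc k))))
        q~k x (inj₂ (k<x , x≤q)) = ⊥-elim (<-asym (<-≤-trans k<x x≤q) q<k′)

    increasing⁻¹ : ∀ {q q′} → SameBlock J q q′ → entry τ q <ᶜ entry τ q′ → toℕ q < toℕ q′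
    increasing⁻¹ {q} {q′} q~q′ lt with <-cmp (toℕ q) (toℕ q′)
    ... | tri< q<q′ _ _ = q<q′
    ... | tri≈ _ q≡q′ _ = ⊥-elim (<ᶜ-irrefl (subst (λ z → entry τ q <ᶜ entry τ z) (sym (FP.toℕ-injective q≡q′)) lt))
    ... | tri> _ _ q′<q = ⊥-elim (<ᶜ-asym lt (increasing q′ q q′<q (SameBlock-sym J q~q′)))

    uncolored : ∀ q → ColoredBlock J q → color τ q ≡ 0
    uncolored = inject₁-induction (λ q → ColoredBlock J q → color τ q ≡ 0) base step
      where
      base : ColoredBlock J fzero → color τ fzero ≡ 0
      base c0 with color τ fzero in eq
      ... | zero  = refl
      ... | suc _ = ⊥-elim (minτ fzero (c0 fzero z≤n) (subst (λ z → ltB (suc (valueℕ fzero) , z) (0 , 0) ≡ true) (sym eq) refl))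
      step : (k : Fin m) → (ColoredBlock J (inject₁ k) → color τ (inject₁ k) ≡ 0) → ColoredBlock J (fsuc k) → color τ (fsuc k) ≡ 0
      step k ih c = <ᶜ-plainˡ (subst (λ z → (suc (valueℕ (inject₁ k)) , z) <ᶜ entry τ (fsuc k)) (ih c′) (ascent k (c (fsuc k) ≤-refl)))
        where
        c′ : ColoredBlock J (inject₁ k)
        c′ x x≤k = c x (≤-trans x≤k (<⇒≤ (inject₁<suc k)))

    value-increasing : ∀ {q q′} → ColoredBlock J q → ColoredBlock J q′ → SameBlock J q q′ → toℕ q < toℕ q′ → valueℕ q < valueℕ q′
    value-increasing {q} {q′} cq cq′ q~q′ q<q′ =
      s≤s⁻¹ (<ᶜ-plain⁻¹ (subst₂ (λ u v → (suc (valueℕ q) , u) <ᶜ (suc (valueℕ q′) , v)) (uncolored q cq) (uncolored q′ cq′)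
                                  (increasing q q′ q<q′ q~q′)))

    value-increasing⁻¹ : ∀ {q q′} → ColoredBlock J q → ColoredBlock J q′ → SameBlock J q q′ → valueℕ q < valueℕ q′ → toℕ q < toℕ q′
    value-increasing⁻¹ {q} {q′} cq cq′ q~q′ Vq<Vq′ =
      increasing⁻¹ q~q′ (subst₂ (λ u v → (suc (valueℕ q) , u) <ᶜ (suc (valueℕ q′) , v)) (sym (uncolored q cq)) (sym (uncolored q′ cq′))
                                (plain<plain (s<s Vq<Vq′)))

    valueℕ-injective : ∀ q q′ → valueℕ q ≡ valueℕ q′ → q ≡ q′
    valueℕ-injective q q′ e = proj₂ cpτ q q′ (FP.toℕ-injective e)

    module _ {δ : Win (suc m)} (D : BlockPreserving J δ) where
      open BlockPreserving D

      entry-mul-colored : ∀ {x} → ColoredBlock J x → entry (mul r τ δ) x ≡ (suc (valueℕ (value δ x)) , color δ x)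
      entry-mul-colored {x} cx = begin
        entry (mul r τ δ) x                         ≡⟨ entry-mul τ δ x ⟩
        (suc (valueℕ q) , (color δ x + color τ q) % r)   ≡⟨ cong (λ c → (suc (valueℕ q) , (color δ x + c) % r)) (uncolored q cq) ⟩
        (suc (valueℕ q) , (color δ x + 0) % r)           ≡⟨ cong (λ c → (suc (valueℕ q) , c % r)) (+-identityʳ _) ⟩
        (suc (valueℕ q) , color δ x % r)                 ≡⟨ cong (suc (valueℕ q) ,_) (color%r δ colPerm x) ⟩
        (suc (valueℕ q) , color δ x)                     ∎
        where
        open ≡-Reasoning
        q = value δ x
        cq = ColoredBlock-transport J cx (sameBlock x)

      entry-mul-uncolored : ∀ {x} → color δ x ≡ 0 → entry (mul r τ δ) x ≡ entry τ (value δ x)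
      entry-mul-uncolored {x} c≡0 = begin
        entry (mul r τ δ) x                         ≡⟨ entry-mul τ δ x ⟩
        (suc (valueℕ q) , (color δ x + color τ q) % r)   ≡⟨ cong (λ c → (suc (valueℕ q) , (c + color τ q) % r)) c≡0 ⟩
        (suc (valueℕ q) , color τ q % r)                 ≡⟨ cong (suc (valueℕ q) ,_) (color%r τ cpτ q) ⟩
        entry τ q                                   ∎
        where
        open ≡-Reasoning
        q = value δ x

      values-sameBlock : ∀ {x y} → SameBlock J x y → SameBlock J (value δ x) (value δ y)
      values-sameBlock x~y = SameBlock-trans J (SameBlock-sym J (sameBlock _)) (SameBlock-trans J x~y (sameBlock _))

      mul-preserves-order-colored : ∀ {x y} → SameBlock J x y → ColoredBlock J x →
                                    ltB (entry (mul r τ δ) x) (entry (mul r τ δ) y) ≡ ltB (entry δ x) (entry δ y)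
      mul-preserves-order-colored {x} {y} x~y cx = begin
        ltB (entry (mul r τ δ) x) (entry (mul r τ δ) y)        ≡⟨ cong₂ ltB (entry-mul-colored cx) (entry-mul-colored cy) ⟩
        ltB (suc (valueℕ q) , color δ x) (suc (valueℕ q′) , color δ y)   ≡⟨ ltB-cong (<ᶜ-relabel {c = color δ x} {color δ y} reflect-< reflect-> reflect-≡)
                                                                            (<ᶜ-relabel {c = color δ x} {color δ y} preserve-< preserve-> preserve-≡) ⟩
        ltB (entry δ x) (entry δ y)                            ∎
        where
        open ≡-Reasoning
        q = value δ x
        q′ = value δ y
        cy = ColoredBlock-transport J cx x~y
        cq = ColoredBlock-transport J cx (sameBlock x)
        cq′ = ColoredBlock-transport J cy (sameBlock y)
        q~q′ = values-sameBlock x~y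
        reflect-< : suc (valueℕ q) < suc (valueℕ q′) → suc (toℕ q) < suc (toℕ q′)
        reflect-< = s<s ∘ value-increasing⁻¹ cq cq′ q~q′ ∘ s≤s⁻¹
        reflect-> : suc (valueℕ q′) < suc (valueℕ q) → suc (toℕ q′) < suc (toℕ q)
        reflect-> = s<s ∘ value-increasing⁻¹ cq′ cq (SameBlock-sym J q~q′) ∘ s≤s⁻¹
        reflect-≡ : suc (valueℕ q) ≡ suc (valueℕ q′) → suc (toℕ q) ≡ suc (toℕ q′)
        reflect-≡ e = cong (suc ∘ toℕ) (valueℕ-injective q q′ (suc-injective e))
        preserve-< : suc (toℕ q) < suc (toℕ q′) → suc (valueℕ q) < suc (valueℕ q′)
        preserve-< = s<s ∘ value-increasing cq cq′ q~q′ ∘ s≤s⁻¹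
        preserve-> : suc (toℕ q′) < suc (toℕ q) → suc (valueℕ q′) < suc (valueℕ q)
        preserve-> = s<s ∘ value-increasing cq′ cq (SameBlock-sym J q~q′) ∘ s≤s⁻¹
        preserve-≡ : suc (toℕ q) ≡ suc (toℕ q′) → suc (valueℕ q) ≡ suc (valueℕ q′)
        preserve-≡ e = cong (suc ∘ valueℕ) (FP.toℕ-injective (suc-injective e))

      mul-preserves-order-uncolored : ∀ {x y} → SameBlock J x y → color δ x ≡ 0 → color δ y ≡ 0 →
                                      ltB (entry (mul r τ δ) x) (entry (mul r τ δ) y) ≡ ltB (entry δ x) (entry δ y)
      mul-preserves-order-uncolored {x} {y} x~y cx≡0 cy≡0 = begin
        ltB (entry (mul r τ δ) x) (entry (mul r τ δ) y)      ≡⟨ cong₂ ltB (entry-mul-uncolored cx≡0) (entry-mul-uncolored cy≡0) ⟩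
        ltB (entry τ q) (entry τ q′)                         ≡⟨ ltB-cong (λ lt → plain<plain (s<s (increasing⁻¹ q~q′ lt)))
                                                                         (λ { (plain<plain lt) → increasing q q′ (s≤s⁻¹ lt) q~q′ }) ⟩
        ltB (suc (toℕ q) , 0) (suc (toℕ q′) , 0)             ≡⟨ cong₂ (λ c d → ltB (suc (toℕ q) , c) (suc (toℕ q′) , d)) (sym cx≡0) (sym cy≡0) ⟩
        ltB (entry δ x) (entry δ y)                          ∎
        where
        open ≡-Reasoning
        q = value δ x
        q′ = value δ y
        q~q′ = values-sameBlock x~y

      -- Within a block τ is increasing, and δ carries colors only in the colored block, where τ is uncolored.
      mul-preserves-order : ∀ {x y} → SameBlock J x y →
                            ltB (entry (mul r τ δ) x) (entry (mul r τ δ) y) ≡ ltB (entry δ x) (entry δ y)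
      mul-preserves-order {x} {y} x~y with color δ x ≟ 0 | color δ y ≟ 0
      ... | yes cx≡0 | yes cy≡0 = mul-preserves-order-uncolored x~y cx≡0 cy≡0
      ... | no  cx≢0 | _        = mul-preserves-order-colored x~y (coloredBlock x cx≢0)
      ... | yes _    | no  cy≢0 = mul-preserves-order-colored x~y
                                    (ColoredBlock-transport J (coloredBlock y cy≢0) (SameBlock-sym J x~y))

      color-zero-preserved : fzero ∈ J → color (mul r τ δ) fzero ≡ color δ fzero
      color-zero-preserved 0∈J = cong proj₂ (entry-mul-colored (ColoredBlock-zero J 0∈J))

      minimal-cancelˡ : InGJmin J (mul r τ δ) → InGJmin J δ
      minimal-cancelˡ minτδ fzero 0∈J d = minτδ fzero 0∈J (colored⇒IsDes-zero (mul r τ δ)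
        (λ c≡0 → IsDes-zero⇒colored δ d (trans (sym (color-zero-preserved 0∈J)) c≡0)))
      minimal-cancelˡ minτδ (fsuc k) k∈J d =
        minτδ (fsuc k) k∈J (trans (mul-preserves-order (SameBlock-sym J (SameBlock-adjacent J k k∈J))) d)

  blockPreserving-minimal⇒identity : ∀ {n} {J : Subset n} {δ} → BlockPreserving J δ → InGJmin J δ → δ ≡ identity
  blockPreserving-minimal⇒identity {zero}  D minδ = lookup-extensionality λ ()
  blockPreserving-minimal⇒identity {suc m} {J} {δ} D minδ = lookup-extensionality λ p →
    trans (cong₂ _,_ (FP.toℕ-injective (sym (fixed p))) (uncolored′ p)) (sym (lookup-identity p))
    where
    open BlockPreserving D
    open MinimalRepresentative J δ colPerm minδ
    uncolored′ : ∀ p → color δ p ≡ 0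
    uncolored′ p with color δ p ≟ 0
    ... | yes c≡0 = c≡0
    ... | no  c≢0 = uncolored p (coloredBlock p c≢0)
    step : (k : Fin m) → toℕ (inject₁ k) ≤ valueℕ (inject₁ k) → toℕ (fsuc k) ≤ valueℕ (fsuc k)
    step k ih with fsuc k ∈? J
    ... | yes k∈J = ≤-trans (s≤s (subst (_≤ valueℕ (inject₁ k)) (FP.toℕ-inject₁ k) ih)) (s≤s⁻¹ (<ᶜ-plain⁻¹ valueℕ-ascent))
      where
      valueℕ-ascent : (suc (valueℕ (inject₁ k)) , 0) <ᶜ (suc (valueℕ (fsuc k)) , 0)
      valueℕ-ascent = subst₂ (λ c d → (suc (valueℕ (inject₁ k)) , c) <ᶜ (suc (valueℕ (fsuc k)) , d))
                        (uncolored′ (inject₁ k)) (uncolored′ (fsuc k)) (ascent k k∈J)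
    ... | no k∉J with toℕ (fsuc k) ≤? valueℕ (fsuc k)
    ...   | yes k≤V = k≤V
    ...   | no  k≰V = ⊥-elim (k∉J (sameBlock (fsuc k) (fsuc k) (inj₂ (≰⇒> k≰V , ≤-refl))))
    fixed : ∀ p → toℕ p ≡ valueℕ p
    fixed = ∑-mono-≤-≡⇒≗ (inject₁-induction (λ p → toℕ p ≤ valueℕ p) z≤n step)
                         (sym (∑-reindex (value δ) (proj₂ colPerm) toℕ))

  -- Length and color under right multiplication by generators

  lenTermSum : ∀ {n} → Win n → ℕ
  lenTermSum w = ∑ λ i → lenTerm (entry w i)

  module AdjacentAscent {m} (w : Win (suc m)) (cp : IsColPerm r w) (k : Fin m)
                        (asc : entry w (inject₁ k) <ᶜ entry w (fsuc k)) where

    u : Win (suc m)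
    u = mul r w (adjacent k)

    swappedInversion : Fin (suc m) → Fin (suc m) → ℕ
    swappedInversion a b = indicator ((toℕ (swap k a) <ᵇ toℕ (swap k b)) ∧ ltB (entry w b) (entry w a))

    isDescentPair : Fin (suc m) → Fin (suc m) → ℕ
    isDescentPair a b = if does (a F.≟ fsuc k) then indicator (does (b F.≟ inject₁ k)) else 0

    inversion-u : ∀ i j → inversion u i j ≡ swappedInversion (swap k i) (swap k j)
    inversion-u i j = begin
      indicator ((toℕ i <ᵇ toℕ j) ∧ ltB (entry u j) (entry u i))
        ≡⟨ cong₂ (λ ej ei → indicator ((toℕ i <ᵇ toℕ j) ∧ ltB ej ei)) (entry-mul-adjacent w cp k j) (entry-mul-adjacent w cp k i) ⟩
      indicator ((toℕ i <ᵇ toℕ j) ∧ ltB (entry w (swap k j)) (entry w (swap k i)))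
        ≡⟨ cong₂ (λ i′ j′ → indicator ((toℕ i′ <ᵇ toℕ j′) ∧ ltB (entry w (swap k j)) (entry w (swap k i))))
                 (sym (swap-involutive k i)) (sym (swap-involutive k j)) ⟩
      swappedInversion (swap k i) (swap k j)  ∎
      where open ≡-Reasoning

    descent-pair : swappedInversion (fsuc k) (inject₁ k) ≡ inversion w (fsuc k) (inject₁ k) + 1
    descent-pair rewrite swap-suc k | swap-inject₁ k | <⇒<ᵇ≡true (inject₁<suc k) | <ᶜ⇒ltB asc
                       | ≮⇒<ᵇ≡false (<-asym (inject₁<suc k)) = refl

    ascent-pair : swappedInversion (inject₁ k) (fsuc k) ≡ inversion w (inject₁ k) (fsuc k) + 0
    ascent-pair rewrite swap-suc k | swap-inject₁ k | <⇒<ᵇ≡true (inject₁<suc k) | ¬<ᶜ⇒ltB≡false (<ᶜ-asym asc)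
                      | ≮⇒<ᵇ≡false (<-asym (inject₁<suc k)) = refl

    other-pair : ∀ a b → ¬ (a ≡ fsuc k × b ≡ inject₁ k) → ¬ (a ≡ inject₁ k × b ≡ fsuc k) →
                 swappedInversion a b ≡ inversion w a b + 0
    other-pair a b h₁ h₂ = trans (cong (λ z → indicator (z ∧ ltB (entry w b) (entry w a))) (swap-preserves-<ᵇ k a b h₁ h₂))
                                 (sym (+-identityʳ _))

    isDescentPair-descent : isDescentPair (fsuc k) (inject₁ k) ≡ 1
    isDescentPair-descent rewrite dec-true (fsuc k F.≟ fsuc k) refl | dec-true (inject₁ k F.≟ inject₁ k) refl = refl

    isDescentPair-other : ∀ {a b} → ¬ (a ≡ fsuc k × b ≡ inject₁ k) → isDescentPair a b ≡ 0
    isDescentPair-other {a} {b} h with a F.≟ fsuc k | b F.≟ inject₁ k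
    ... | yes e₁ | yes e₂ = ⊥-elim (h (e₁ , e₂))
    ... | yes _  | no  _  = refl
    ... | no  _  | _      = refl

    swappedInversion-split : ∀ a b → swappedInversion a b ≡ inversion w a b + isDescentPair a b
    swappedInversion-split a b with (a F.≟ fsuc k) ×-dec (b F.≟ inject₁ k) | (a F.≟ inject₁ k) ×-dec (b F.≟ fsuc k)
    ... | yes (refl , refl) | _                 = trans descent-pair (cong (inversion w a b +_) (sym isDescentPair-descent))
    ... | no  ¬desc         | yes (refl , refl) = trans ascent-pair (cong (inversion w a b +_) (sym (isDescentPair-other ¬desc)))
    ... | no  ¬desc         | no  ¬asc          = trans (other-pair a b ¬desc ¬asc) (cong (inversion w a b +_) (sym (isDescentPair-other ¬desc)))

    ∑∑-isDescentPair : ∑ (λ a → ∑ (isDescentPair a)) ≡ 1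
    ∑∑-isDescentPair = trans (∑-cong (λ a → row (does (a F.≟ fsuc k)))) (∑-indicator-≡ (fsuc k))
      where
      row : ∀ b → ∑ (λ c → if b then indicator (does (c F.≟ inject₁ k)) else 0) ≡ indicator b
      row true  = ∑-indicator-≡ (inject₁ k)
      row false = ∑-zero {suc m}

    invG-mul-adjacent : invG u ≡ invG w + 1
    invG-mul-adjacent = begin
      ∑ (λ i → ∑ (inversion u i))                                      ≡⟨ ∑-cong (λ i → ∑-cong (inversion-u i)) ⟩
      ∑ (λ i → ∑ (λ j → swappedInversion (swap k i) (swap k j)))      ≡⟨ ∑-cong (λ i → ∑-reindex (swap k) (swap-injective k) (swappedInversion (swap k i))) ⟩
      ∑ (λ i → ∑ (swappedInversion (swap k i)))                        ≡⟨ ∑-reindex (swap k) (swap-injective k) (λ a → ∑ (swappedInversion a)) ⟩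
      ∑ (λ a → ∑ (swappedInversion a))                                 ≡⟨ ∑-cong (λ a → trans (∑-cong (swappedInversion-split a)) (∑-distrib-+ (inversion w a) (isDescentPair a))) ⟩
      ∑ (λ a → ∑ (inversion w a) + ∑ (isDescentPair a))                ≡⟨ ∑-distrib-+ (λ a → ∑ (inversion w a)) (λ a → ∑ (isDescentPair a)) ⟩
      invG w + ∑ (λ a → ∑ (isDescentPair a))                           ≡⟨ cong (invG w +_) ∑∑-isDescentPair ⟩
      invG w + 1                                                       ∎
      where open ≡-Reasoning

    lenTermSum-mul-adjacent : lenTermSum u ≡ lenTermSum w
    lenTermSum-mul-adjacent = trans (∑-cong (λ p → cong lenTerm (entry-mul-adjacent w cp k p)))
                                    (∑-reindex (swap k) (swap-injective k) (λ p → lenTerm (entry w p)))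

    lengthG-mul-adjacent : lengthG u ≡ lengthG w + 1
    lengthG-mul-adjacent = begin
      invG u + lenTermSum u        ≡⟨ cong₂ _+_ invG-mul-adjacent lenTermSum-mul-adjacent ⟩
      invG w + 1 + lenTermSum w    ≡⟨ +-assoc (invG w) 1 (lenTermSum w) ⟩
      invG w + (1 + lenTermSum w)  ≡⟨ cong (invG w +_) (+-comm 1 (lenTermSum w)) ⟩
      invG w + (lenTermSum w + 1)  ≡⟨ sym (+-assoc (invG w) (lenTermSum w) 1) ⟩
      lengthG w + 1                ∎
      where open ≡-Reasoning

    colG-mul-adjacent : colG u ≡ colG w + 0
    colG-mul-adjacent = trans (∑-cong (λ p → cong proj₂ (lookup-mul-adjacent w cp k p)))
                              (trans (∑-reindex (swap k) (swap-injective k) (color w)) (sym (+-identityʳ _)))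

  module TwistUncoloredFirst {m} (w : Win (suc m)) (cp : IsColPerm r w) (uncolored : color w fzero ≡ 0) (c : ℕ) (c<r : suc c < r) where

    u : Win (suc m)
    u = mul r w (twist (suc c))

    v : ℕ
    v = toℕ (value w fzero)

    lookup-u-zero : lookup u fzero ≡ (value w fzero , suc c)
    lookup-u-zero = trans (lookup-mul-twist w (suc c) fzero) (cong (value w fzero ,_) (begin
      (suc c % r + color w fzero) % r   ≡⟨ cong (λ z → (suc c % r + z) % r) uncolored ⟩
      (suc c % r + 0) % r               ≡⟨ cong (_% r) (+-identityʳ _) ⟩
      suc c % r % r                     ≡⟨ m%n%n≡m%n (suc c) r ⟩
      suc c % r                         ≡⟨ m<n⇒m%n≡m c<r ⟩
      suc c                             ∎))
      where open ≡-Reasoning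

    entry-u-zero : entry u fzero ≡ (suc v , suc c)
    entry-u-zero = cong (λ z → (suc (toℕ (proj₁ z)) , proj₂ z)) lookup-u-zero

    entry-u-suc : ∀ p → entry u (fsuc p) ≡ entry w (fsuc p)
    entry-u-suc p = cong (λ z → (suc (toℕ (proj₁ z)) , proj₂ z)) (lookup-mul-twist-suc w cp (suc c) p)

    colG-mul-twist : colG u ≡ colG w + suc c
    colG-mul-twist = begin
      color u fzero + ∑ (color u ∘ fsuc)  ≡⟨ cong₂ _+_ (cong proj₂ lookup-u-zero) (∑-cong (λ p → cong proj₂ (lookup-mul-twist-suc w cp (suc c) p))) ⟩
      suc c + ∑ (color w ∘ fsuc)          ≡⟨ +-comm (suc c) _ ⟩
      ∑ (color w ∘ fsuc) + suc c          ≡⟨ cong (λ z → z + ∑ (color w ∘ fsuc) + suc c) (sym uncolored) ⟩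
      colG w + suc c                      ∎
      where open ≡-Reasoning

    belowColored : ℕ
    belowColored = ∑ λ j → indicator (ltB (entry w (fsuc j)) (suc v , suc c))

    inversions-zero-u : ∑ (inversion u fzero) ≡ belowColored
    inversions-zero-u = ∑-cong λ j → cong₂ (λ ej e0 → indicator (ltB ej e0)) (entry-u-suc j) entry-u-zero

    values-below-v : ∑ (λ j → indicator (toℕ (value w (fsuc j)) <ᵇ v)) ≡ v
    values-below-v = begin
      ∑ (λ j → indicator (toℕ (value w (fsuc j)) <ᵇ v))
        ≡⟨ cong (_+ ∑ (λ j → indicator (toℕ (value w (fsuc j)) <ᵇ v))) (cong indicator (sym (<ᵇ-irrefl v))) ⟩
      ∑ (λ q → indicator (toℕ (value w q) <ᵇ v))     ≡⟨ ∑-reindex (value w) (proj₂ cp) (λ q → indicator (toℕ q <ᵇ v)) ⟩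
      ∑ {suc m} (λ q → indicator (toℕ q <ᵇ v))       ≡⟨ ∑-indicator-< v (<⇒≤ (FP.toℕ<n (value w fzero))) ⟩
      v                                              ∎
      where open ≡-Reasoning

    inversions-zero-w : ∑ (inversion w fzero) ≡ belowColored + v
    inversions-zero-w = begin
      ∑ (λ j → indicator (ltB (entry w (fsuc j)) (suc v , color w fzero)))
        ≡⟨ ∑-cong (λ j → cong (λ z → indicator (ltB (entry w (fsuc j)) (suc v , z))) uncolored) ⟩
      ∑ (λ j → indicator (ltB (entry w (fsuc j)) (suc v , 0)))
        ≡⟨ ∑-cong (λ j → indicator-below-plain _ (color w (fsuc j)) (suc v) c (value-≢ j)) ⟩
      ∑ (λ j → indicator (ltB (entry w (fsuc j)) (suc v , suc c)) + indicator (toℕ (value w (fsuc j)) <ᵇ v))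
        ≡⟨ ∑-distrib-+ (λ j → indicator (ltB (entry w (fsuc j)) (suc v , suc c))) (λ j → indicator (toℕ (value w (fsuc j)) <ᵇ v)) ⟩
      belowColored + ∑ (λ j → indicator (toℕ (value w (fsuc j)) <ᵇ v))
        ≡⟨ cong (belowColored +_) values-below-v ⟩
      belowColored + v  ∎
      where
      open ≡-Reasoning
      value-≢ : ∀ j → suc (toℕ (value w (fsuc j))) ≢ suc v
      value-≢ j = entry-injective w cp (λ ())

    inversions-suc-u : ∀ i j → inversion u (fsuc i) j ≡ inversion w (fsuc i) j
    inversions-suc-u i fzero    = refl
    inversions-suc-u i (fsuc j) =
      cong₂ (λ ei ej → indicator ((suc (toℕ i) <ᵇ suc (toℕ j)) ∧ ltB ej ei)) (entry-u-suc i) (entry-u-suc j)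

    lengthG-mul-twist : lengthG u ≡ lengthG w + suc c
    lengthG-mul-twist = begin
      lengthG u
        ≡⟨ cong₂ _+_ (cong₂ _+_ inversions-zero-u (∑-cong (λ i → ∑-cong (inversions-suc-u i))))
                     (cong₂ _+_ (cong lenTerm entry-u-zero) (∑-cong (λ p → cong lenTerm (entry-u-suc p)))) ⟩
      (belowColored + inversionsRest) + ((suc v + c) + lenTermRest)
        ≡⟨ solve 5 (λ b i x y l → (b :+ i) :+ ((con 1 :+ x :+ y) :+ l) := ((b :+ x) :+ i) :+ l :+ (con 1 :+ y))
                 refl belowColored inversionsRest v c lenTermRest ⟩
      ((belowColored + v) + inversionsRest) + lenTermRest + suc c
        ≡⟨ cong (λ z → z + suc c) (sym (cong₂ _+_ (cong (_+ inversionsRest) inversions-zero-w) lenTermSum-w)) ⟩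
      lengthG w + suc c ∎
      where
      open ≡-Reasoning
      open +-*-Solver
      inversionsRest = ∑ (λ i → ∑ (inversion w (fsuc i)))
      lenTermRest = ∑ (λ p → lenTerm (entry w (fsuc p)))
      lenTermSum-w : lenTermSum w ≡ lenTermRest
      lenTermSum-w = cong (λ z → lenTerm (suc v , z) + lenTermRest) uncolored

  inversion-identity : ∀ {n} (i j : Fin n) → inversion identity i j ≡ 0
  inversion-identity i j rewrite lookup-identity i | lookup-identity j with toℕ i <ᵇ toℕ j in eq
  ... | false = refl
  ... | true rewrite ≮⇒<ᵇ≡false (<-asym (<ᵇ⇒< (toℕ i) (toℕ j) (≡true⇒T eq))) = refl

  lengthG-identity : ∀ {n} → lengthG (identity {n}) ≡ 0
  lengthG-identity {n} = cong₂ _+_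
    (trans (∑-cong {n} (λ i → trans (∑-cong {n} (inversion-identity i)) (∑-zero {n}))) (∑-zero {n}))
    (trans (∑-cong {n} (λ p → cong (λ z → lenTerm (suc (toℕ (proj₁ z)) , proj₂ z)) (lookup-identity p))) (∑-zero {n}))

  colG-identity : ∀ {n} → colG (identity {n}) ≡ 0
  colG-identity {n} = trans (∑-cong {n} (λ p → cong proj₂ (lookup-identity p))) (∑-zero {n})

  minimal-cancelˡ : ∀ {n} {J : Subset n} (τ : Win n) {δ} → IsColPerm r τ → InGJmin J τ → BlockPreserving J δ →
                    InGJmin J (mul r τ δ) → InGJmin J δ
  minimal-cancelˡ {zero}  τ cpτ minτ D minτδ ()
  minimal-cancelˡ {suc m} {J} τ cpτ minτ D = MinimalRepresentative.minimal-cancelˡ J τ cpτ minτ D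

  record Factorization {n} (J : Subset n) (γ : Win n) : Set where
    field
      τ δ              : Win n
      τ-colPerm        : IsColPerm r τ
      τ-minimal        : InGJmin J τ
      δ∈G_J            : InGJ r J δ
      γ≡τδ             : γ ≡ mul r τ δ
      lengthG-additive : lengthG γ ≡ lengthG τ + lengthG δ
      colG-additive    : colG γ ≡ colG τ + colG δ
      unique           : ∀ τ′ δ′ → IsColPerm r τ′ → InGJmin J τ′ → InGJ r J δ′ → γ ≡ mul r τ′ δ′ → τ′ ≡ τ × δ′ ≡ δ

  factorization-minimal : ∀ {n} {J : Subset n} {γ} → IsColPerm r γ → InGJmin J γ → Factorization J γ
  factorization-minimal {n} {J} {γ} cp minγ = record
    { τ                = γ
    ; δ                = identity
    ; τ-colPerm        = cp
    ; τ-minimal        = minγ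
    ; δ∈G_J            = g-id
    ; γ≡τδ             = sym (mul-identityʳ γ cp)
    ; lengthG-additive = sym (trans (cong (lengthG γ +_) (lengthG-identity {n})) (+-identityʳ _))
    ; colG-additive    = sym (trans (cong (colG γ +_) (colG-identity {n})) (+-identityʳ _))
    ; unique           = unique
    }
    where
    unique : ∀ τ′ δ′ → IsColPerm r τ′ → InGJmin J τ′ → InGJ r J δ′ → γ ≡ mul r τ′ δ′ → τ′ ≡ γ × δ′ ≡ identity
    unique τ′ δ′ cp′ min′ δ′∈ γ≡τ′δ′ = sym (trans γ≡τ′δ′ (trans (cong (mul r τ′) δ′≡1) (mul-identityʳ τ′ cp′))) , δ′≡1
      where
      D = ∈G_J⇒blockPreserving δ′∈
      δ′≡1 : δ′ ≡ identity
      δ′≡1 = blockPreserving-minimal⇒identity D (minimal-cancelˡ τ′ cp′ min′ D (subst (InGJmin J) γ≡τ′δ′ minγ))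

  SmallerFactorizations : ∀ {n} → Subset n → Win n → Set
  SmallerFactorizations J γ = ∀ {γ′} → lengthG γ′ < lengthG γ → IsColPerm r γ′ → Factorization J γ′

  -- The common shape of both inductive steps: h undoes g, right multiplication by h adds fixed amounts
  -- to length and color on windows with the property Ascent, and δ inherits Ascent from τδ.
  factorization-lift : ∀ {n} {J : Subset n} {γ g h : Win n} (Ascent : Win n → Set) {ℓ c : ℕ} →
    IsColPerm r γ → InGJ r J g → InGJ r J h →
    (∀ x → IsColPerm r x → mul r (mul r x g) h ≡ x) →
    (∀ τ {δ} → IsColPerm r τ → InGJmin J τ → InGJ r J δ → Ascent (mul r τ δ) → Ascent δ) →
    (∀ x → IsColPerm r x → Ascent x → lengthG (mul r x h) ≡ lengthG x + suc ℓ × colG (mul r x h) ≡ colG x + c) →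
    Ascent (mul r γ g) → SmallerFactorizations J γ → Factorization J γ
  factorization-lift {J = J} {γ} {g} {h} Ascent {ℓ} {c} cpγ g∈ h∈ cancel transfer grow asc IH = record
    { τ                = τ
    ; δ                = mul r δ h
    ; τ-colPerm        = τ-colPerm
    ; τ-minimal        = τ-minimal
    ; δ∈G_J            = g-mul δ∈G_J h∈
    ; γ≡τδ             = trans (sym (cancel γ cpγ)) (trans (cong (λ z → mul r z h) γ≡τδ) (mul-assoc τ δ h))
    ; lengthG-additive = additive lengthG (proj₁ (grow (mul r γ g) cpγg asc)) lengthG-additive (proj₁ (grow δ cpδ ascδ))
    ; colG-additive    = additive colG (proj₂ (grow (mul r γ g) cpγg asc)) colG-additive (proj₂ (grow δ cpδ ascδ))
    ; unique           = unique′
    }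
    where
    cpγg = mul-colPerm γ g cpγ (∈G_J⇒colPerm g∈)
    smaller : lengthG (mul r γ g) < lengthG γ
    smaller = subst (lengthG (mul r γ g) <_) (trans (sym (proj₁ (grow (mul r γ g) cpγg asc))) (cong lengthG (cancel γ cpγ)))
                    (m<m+n (lengthG (mul r γ g)) z<s)
    open Factorization (IH {mul r γ g} smaller cpγg)
    cpδ = ∈G_J⇒colPerm δ∈G_J
    ascδ : Ascent δ
    ascδ = transfer τ τ-colPerm τ-minimal δ∈G_J (subst Ascent γ≡τδ asc)
    additive : (f : Win _ → ℕ) {k : ℕ} → f (mul r (mul r γ g) h) ≡ f (mul r γ g) + k → f (mul r γ g) ≡ f τ + f δ →
               f (mul r δ h) ≡ f δ + k → f γ ≡ f τ + f (mul r δ h)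
    additive f {k} γgh γg δh = begin
      f γ                       ≡⟨ cong f (sym (cancel γ cpγ)) ⟩
      f (mul r (mul r γ g) h)   ≡⟨ γgh ⟩
      f (mul r γ g) + k         ≡⟨ cong (_+ k) γg ⟩
      f τ + f δ + k             ≡⟨ +-assoc (f τ) (f δ) k ⟩
      f τ + (f δ + k)           ≡⟨ cong (f τ +_) (sym δh) ⟩
      f τ + f (mul r δ h)       ∎
      where open ≡-Reasoning
    unique′ : ∀ τ′ δ′ → IsColPerm r τ′ → InGJmin J τ′ → InGJ r J δ′ → γ ≡ mul r τ′ δ′ → τ′ ≡ τ × δ′ ≡ mul r δ h
    unique′ τ′ δ′ cp′ min′ δ′∈ γ≡τ′δ′ =
      proj₁ τ′,δ′g , trans (sym (cancel δ′ (∈G_J⇒colPerm δ′∈))) (cong (λ z → mul r z h) (proj₂ τ′,δ′g))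
      where
      τ′,δ′g = unique τ′ (mul r δ′ g) cp′ min′ (g-mul δ′∈ g∈) (trans (cong (λ z → mul r z g) γ≡τ′δ′) (mul-assoc τ′ δ′ g))

  factorization-adjacent : ∀ {m} {J : Subset (suc m)} {γ} → IsColPerm r γ → (k : Fin m) → fsuc k ∈ J →
                           IsDes γ (fsuc k) → SmallerFactorizations J γ → Factorization J γ
  factorization-adjacent {J = J} {γ} cp k k∈J des =
    factorization-lift Ascent cp sₖ∈G_J sₖ∈G_J (λ x cpx → mul-adjacent-adjacent x cpx k) transfer grow ascent-γsₖ
    where
    sₖ∈G_J = g-gen (fsuc k) k∈J
    Ascent : Win _ → Set
    Ascent x = entry x (inject₁ k) <ᶜ entry x (fsuc k)
    transfer : ∀ τ {δ} → IsColPerm r τ → InGJmin J τ → InGJ r J δ → Ascent (mul r τ δ) → Ascent δ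
    transfer τ cpτ minτ δ∈ asc = ltB⇒<ᶜ _ _ (trans
      (sym (MinimalRepresentative.mul-preserves-order J τ cpτ minτ (∈G_J⇒blockPreserving δ∈) (SameBlock-adjacent J k k∈J)))
      (<ᶜ⇒ltB asc))
    grow : ∀ x → IsColPerm r x → Ascent x → lengthG (mul r x (adjacent k)) ≡ lengthG x + 1 × colG (mul r x (adjacent k)) ≡ colG x + 0
    grow x cpx asc = AdjacentAscent.lengthG-mul-adjacent x cpx k asc , AdjacentAscent.colG-mul-adjacent x cpx k asc
    ascent-γsₖ : Ascent (mul r γ (adjacent k))
    ascent-γsₖ = subst₂ _<ᶜ_ (sym (trans (entry-mul-adjacent γ cp k (inject₁ k)) (cong (entry γ) (swap-inject₁ k))))
                              (sym (trans (entry-mul-adjacent γ cp k (fsuc k)) (cong (entry γ) (swap-suc k))))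
                              (ltB⇒<ᶜ _ _ des)

  factorization-twist : ∀ {m} {J : Subset (suc m)} {γ} → IsColPerm r γ → fzero ∈ J →
                        IsDes γ fzero → SmallerFactorizations J γ → Factorization J γ
  factorization-twist {J = J} {γ} cp 0∈J des =
    factorization-lift Ascent cp (twist∈G_J J 0∈J (r ∸ suc c)) (twist∈G_J J 0∈J (suc c))
                       (λ x cpx → mul-twist-cancel x cpx (suc c) (<⇒≤ c<r)) transfer grow uncolored-γt
    where
    c : ℕ
    c = pred (color γ fzero)
    c₀≡ : color γ fzero ≡ suc c
    c₀≡ = sym (suc-pred (color γ fzero) {{≢-nonZero (IsDes-zero⇒colored γ des)}})
    c<r : suc c < r
    c<r = subst (_< r) c₀≡ (proj₁ cp fzero)
    Ascent : Win _ → Set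
    Ascent x = color x fzero ≡ 0
    transfer : ∀ τ {δ} → IsColPerm r τ → InGJmin J τ → InGJ r J δ → Ascent (mul r τ δ) → Ascent δ
    transfer τ cpτ minτ δ∈ c≡0 =
      trans (sym (MinimalRepresentative.color-zero-preserved J τ cpτ minτ (∈G_J⇒blockPreserving δ∈) 0∈J)) c≡0
    grow : ∀ x → IsColPerm r x → Ascent x →
           lengthG (mul r x (twist (suc c))) ≡ lengthG x + suc c × colG (mul r x (twist (suc c))) ≡ colG x + suc c
    grow x cpx c≡0 = TwistUncoloredFirst.lengthG-mul-twist x cpx c≡0 c c<r , TwistUncoloredFirst.colG-mul-twist x cpx c≡0 c c<r
    uncolored-γt : Ascent (mul r γ (twist (r ∸ suc c)))
    uncolored-γt = begin
      color (mul r γ (twist (r ∸ suc c))) fzero   ≡⟨ cong proj₂ (lookup-mul-twist γ (r ∸ suc c) fzero) ⟩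
      ((r ∸ suc c) % r + color γ fzero) % r       ≡⟨ cong (λ z → ((r ∸ suc c) % r + z) % r) c₀≡ ⟩
      ((r ∸ suc c) % r + suc c) % r               ≡⟨ [m%r+n]%r≡[m+n]%r (r ∸ suc c) (suc c) ⟩
      (r ∸ suc c + suc c) % r                     ≡⟨ cong (_% r) (m∸n+n≡m (<⇒≤ c<r)) ⟩
      r % r                                       ≡⟨ n%n≡0 r ⟩
      0                                           ∎
      where open ≡-Reasoning

  factorize : ∀ {n} (J : Subset n) (γ : Win n) → IsColPerm r γ → Factorization J γ
  factorize {n} J = All.wfRec (On.wellFounded lengthG <-wellFounded) _ (λ γ → IsColPerm r γ → Factorization J γ) step
    where
    step : ∀ γ → SmallerFactorizations J γ → IsColPerm r γ → Factorization J γ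
    step γ IH cp with FP.any? (λ i → (i ∈? J) ×-dec (ltB (entry γ i) (prevEntry γ i) BP.≟ true))
    ... | no  none                 = factorization-minimal cp (λ i i∈J d → none (i , i∈J , d))
    ... | yes (fzero  , 0∈J , des) = factorization-twist cp 0∈J des IH
    ... | yes (fsuc k , k∈J , des) = factorization-adjacent cp k k∈J des IH

proposition4p1 : (r n : ℕ) {{_ : NonZero r}} (J : Subset n) (γ : Win n) → IsColPerm r γ →
    Σ (Win n) (λ τ → Σ (Win n) (λ δ →
      (IsColPerm r τ × InGJmin J τ × IsColPerm r δ × InGJ r J δ × γ ≡ mul r τ δ ×
       lengthG γ ≡ lengthG τ + lengthG δ × colG γ ≡ colG τ + colG δ) ×
      ((τ′ δ′ : Win n) → IsColPerm r τ′ → InGJmin J τ′ → InGJ r J δ′ →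
         γ ≡ mul r τ′ δ′ → τ′ ≡ τ × δ′ ≡ δ)))
proposition4p1 r n J γ cp =
  τ , δ , (τ-colPerm , τ-minimal , ∈G_J⇒colPerm δ∈G_J , δ∈G_J , γ≡τδ , lengthG-additive , colG-additive) , unique
  where
  open ColoredPermutations r
  open Factorization (factorize J γ cp)
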